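{- Let $A=\begin{pmatrix} a & b \\ c & 0 \end{pmatrix}\in M_2(\mathbb{Z})$ with $bc\neq 0$ and $\gcd(a,b,c)=1$, let $K=\mathbb{Q}(\sqrt{a^2+4bc})$ with ring of integers $\mathcal{O}_K$, let $u,v,w$ be nonzero integers with $\gcd(u,v,w)=1$, and let $n$ be a positive integer. Then there exist $X,Y,Z\in C(A)$ with $\det(XYZ)\neq 0$ and $uX^n+vY^n=wZ^n$ if and only if there exist $x,y,z\in\mathcal{O}_K$ with $xyz\neq 0$ and $ux^n+vy^n=wz^n$.
   Context: $C(A)=\{B\in M_2(\mathbb{Z}): AB=BA\}$. If $a^2+4bc$ is a square, $K=\mathbb{Q}$ and $\mathcal{O}_K=\mathbb{Z}$. -}

module Defs where

open import Data.Nat using (ℕ; zero; suc)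
open import Data.Nat.GCD using (gcd)
open import Data.Integer as ℤ using (ℤ; ∣_∣)
open import Data.Rational as ℚ using (ℚ)
open import Data.List using (List; []; _∷_)
open import Data.Product using (Σ; ∃; ∃-syntax; _×_; _,_)
open import Data.Sum using (_⊎_)
open import Relation.Nullary using (¬_)
open import Relation.Binary.PropositionalEquality using (_≡_)

gcd3≡1 : ℤ → ℤ → ℤ → Set
gcd3≡1 a b c = gcd (gcd ∣ a ∣ ∣ b ∣) ∣ c ∣ ≡ 1

record M2 : Set where
  constructor mat
  field
    m11 m12 m21 m22 : ℤ

open M2 public

_·_ : M2 → M2 → M2
mat p q r s · mat p' q' r' s' =
  mat (p ℤ.* p' ℤ.+ q ℤ.* r') (p ℤ.* q' ℤ.+ q ℤ.* s')
      (r ℤ.* p' ℤ.+ s ℤ.* r') (r ℤ.* q' ℤ.+ s ℤ.* s')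

_⊕_ : M2 → M2 → M2
mat p q r s ⊕ mat p' q' r' s' = mat (p ℤ.+ p') (q ℤ.+ q') (r ℤ.+ r') (s ℤ.+ s')

_⊛_ : ℤ → M2 → M2
k ⊛ mat p q r s = mat (k ℤ.* p) (k ℤ.* q) (k ℤ.* r) (k ℤ.* s)

I₂ : M2
I₂ = mat (ℤ.+ 1) (ℤ.+ 0) (ℤ.+ 0) (ℤ.+ 1)

_^M_ : M2 → ℕ → M2
X ^M zero = I₂
X ^M suc n = X · (X ^M n)

det : M2 → ℤ
det (mat p q r s) = p ℤ.* s ℤ.- q ℤ.* r

InC : M2 → M2 → Set
InC A B = A · B ≡ B · A

_^ℤ_ : ℤ → ℕ → ℤ
x ^ℤ zero = ℤ.+ 1
x ^ℤ suc n = x ℤ.* (x ^ℤ n)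

IsSquareℤ : ℤ → Set
IsSquareℤ D = ∃[ s ] s ℤ.* s ≡ D

-- The quadratic field K = ℚ(√D) for D not a square in ℤ:
-- element  (p , q)  represents  p + q √D  with p q ∈ ℚ.

K : Set
K = ℚ × ℚ

module QuadField (D : ℤ) where

  Dℚ : ℚ
  Dℚ = D ℚ./ 1

  _+K_ : K → K → K
  (p , q) +K (r , s) = (p ℚ.+ r , q ℚ.+ s)

  _*K_ : K → K → K
  (p , q) *K (r , s) = (p ℚ.* r ℚ.+ Dℚ ℚ.* (q ℚ.* s) , p ℚ.* s ℚ.+ q ℚ.* r)

  0K : K
  0K = (ℚ.0ℚ , ℚ.0ℚ)

  1K : K
  1K = (ℚ.1ℚ , ℚ.0ℚ)

  ιK : ℤ → K
  ιK k = (k ℚ./ 1 , ℚ.0ℚ)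

  _^K_ : K → ℕ → K
  x ^K zero = 1K
  x ^K suc n = x *K (x ^K n)

  -- evaluation of the monic polynomial  t^(length cs) + Σ_i cs[i] t^i
  -- (coefficients cs listed from the constant term upward) at x ∈ K
  evalMonic : List ℤ → K → K
  evalMonic [] x = 1K
  evalMonic (c ∷ cs) x = ιK c +K (x *K evalMonic cs x)

  -- x is an algebraic integer: a root of a monic polynomial in ℤ[t]
  InOK : K → Set
  InOK x = ∃[ cs ] evalMonic cs x ≡ 0K

MatrixSolvable : M2 → ℤ → ℤ → ℤ → ℕ → Set
MatrixSolvable A u v w n =
  ∃[ X ] ∃[ Y ] ∃[ Z ]
    InC A X × InC A Y × InC A Z ×
    ¬ (det (X · (Y · Z)) ≡ ℤ.+ 0) ×
    ((u ⊛ (X ^M n)) ⊕ (v ⊛ (Y ^M n)) ≡ w ⊛ (Z ^M n))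

-- ∃ x y z ∈ 𝒪_K, xyz ≠ 0, u xⁿ + v yⁿ = w zⁿ,  K = ℚ(√D)
-- (if D is a square in ℤ then K = ℚ and 𝒪_K = ℤ)
OKSolvable : ℤ → ℤ → ℤ → ℤ → ℕ → Set
OKSolvable D u v w n =
  (IsSquareℤ D ×
    ∃[ x ] ∃[ y ] ∃[ z ]
      ¬ (x ℤ.* (y ℤ.* z) ≡ ℤ.+ 0) ×
      (u ℤ.* (x ^ℤ n) ℤ.+ v ℤ.* (y ^ℤ n) ≡ w ℤ.* (z ^ℤ n)))
  ⊎
  (¬ IsSquareℤ D ×
    ∃[ x ] ∃[ y ] ∃[ z ]
      InOK x × InOK y × InOK z ×
      ¬ (x *K (y *K z) ≡ 0K) ×
      ((ιK u *K (x ^K n)) +K (ιK v *K (y ^K n)) ≡ ιK w *K (z ^K n)))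
  where open QuadField D

{-# OPTIONS --safe #-}
module Submission where

-- Let D = a² + 4bc. The matrix J = 2A − a·I satisfies J² = D·I, so m + k√D ↦ m·I + k·J is a
-- ring homomorphism ℤ[√D] → C(A), injective as b ≠ 0, turning the norm into the determinant;
-- conversely, every B ∈ C(A) has 2b·B = m·I + k·J for some m, k ∈ ℤ. The equation
-- u xⁿ + v yⁿ = w zⁿ is homogeneous, so scaling by 2b identifies matrix solutions with
-- solutions in ℤ[√D] of nonzero norm. If D = s², evaluation at √D = s carries these to integer
-- solutions, and the norm is the product of the evaluations at s and −s. Otherwise
-- ℤ[√D] ⊆ 𝒪_K ⊆ K, clearing denominators turns any solution in K into one in ℤ[√D], and nonzero
-- elements of ℤ[√D] have nonzero norm.

open import Defs
open import Data.Nat using (ℕ; NonZero)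
open import Data.Integer using (ℤ; _+_; _*_; +_)
open import Data.Product using (_×_)
open import Function.Bundles using (_⇔_; mk⇔)
open import Relation.Nullary using (¬_)
open import Relation.Binary.PropositionalEquality using (_≡_; cong)

open import Data.Integer using (0ℤ; -_; _-_; -[1+_]; +[1+_]; ∣_∣; ≢-nonZero)
import Data.Integer.Properties as ℤₚ
open import Data.Integer.Tactic.RingSolver using (solve)
open import Data.List using (List; []; _∷_)
open import Data.Nat as ℕ using (zero; suc)
open import Data.Nat.Coprimality using (coprime-/gcd; coprime-divisor) renaming (sym to coprime-sym)
open import Data.Nat.Divisibility using (divides; ∣-refl) renaming (_∣_ to _∣ℕ_)
open import Data.Nat.DivMod using (m/n*n≡m) renaming (_/_ to _div_)
open import Data.Nat.GCD using (gcd; gcd[m,n]∣m; gcd[m,n]∣n; gcd[m,n]≢0)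
import Data.Nat.Properties as ℕₚ
open import Data.Product using (_,_; proj₁; proj₂; ∃-syntax)
open import Data.Rational as ℚ using (ℚ; mkℚ; 0ℚ; ↥_; ↧_)
import Data.Rational.Properties as ℚₚ
open import Data.Rational.Solver using () renaming (module +-*-Solver to ℚ-Solver)
open import Data.Rational.Unnormalised as ℚᵘ using (mkℚᵘ; *≡*)
import Data.Rational.Unnormalised.Properties as ℚᵘₚ
open import Data.Sum using (inj₁; inj₂; [_,_]′)
open import Function using (id; _∘_)
open import Function.Definitions using (Injective)
open import Relation.Nullary using (Dec; yes; no; contradiction)
open import Relation.Nullary.Decidable using (map′)
open import Relation.Binary.PropositionalEquality
  using (_≢_; refl; sym; trans; cong₂; subst; module ≡-Reasoning)
open import Algebra.Properties.CommutativeSemigroup ℕₚ.*-commutativeSemigroup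
  using () renaming (interchange to ℕ-interchange)
open import Algebra.Properties.CommutativeSemigroup ℤₚ.*-commutativeSemigroup
  using () renaming (x∙yz≈y∙xz to ℤ-x∙yz≈y∙xz)

*-≢0 : ∀ {i j} → i ≢ 0ℤ → j ≢ 0ℤ → i * j ≢ 0ℤ
*-≢0 {i} i≢0 j≢0 ij≡0 = [ i≢0 , j≢0 ]′ (ℤₚ.i*j≡0⇒i≡0∨j≡0 i ij≡0)

m²≡dk²⇒∃s²≡d : ∀ m d k → k ≢ 0 → m ℕ.* m ≡ d ℕ.* (k ℕ.* k) → ∃[ s ] s ℕ.* s ≡ d
m²≡dk²⇒∃s²≡d m d k k≢0 m²≡dk² = m′ , (begin
  m′ ℕ.* m′            ≡⟨ reduced ⟩
  d ℕ.* (k′ ℕ.* k′)    ≡⟨ cong (λ j → d ℕ.* (j ℕ.* j)) k′≡1 ⟩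
  d ℕ.* 1              ≡⟨ ℕₚ.*-identityʳ d ⟩
  d                    ∎)
  where
    open ≡-Reasoning
    g = gcd m k
    instance
      g≢0 : NonZero g
      g≢0 = ℕ.≢-nonZero (gcd[m,n]≢0 m k (inj₂ k≢0))
      g²≢0 : NonZero (g ℕ.* g)
      g²≢0 = ℕₚ.m*n≢0 g g
    m′ = m div g
    k′ = k div g
    reduced : m′ ℕ.* m′ ≡ d ℕ.* (k′ ℕ.* k′)
    reduced = ℕₚ.*-cancelʳ-≡ _ _ (g ℕ.* g) (begin
      (m′ ℕ.* m′) ℕ.* (g ℕ.* g)          ≡⟨ ℕ-interchange m′ m′ g g ⟩
      (m′ ℕ.* g) ℕ.* (m′ ℕ.* g)          ≡⟨ cong (λ j → j ℕ.* j) (m/n*n≡m (gcd[m,n]∣m m k)) ⟩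
      m ℕ.* m                            ≡⟨ m²≡dk² ⟩
      d ℕ.* (k ℕ.* k)                    ≡⟨ cong (λ j → d ℕ.* (j ℕ.* j)) (sym (m/n*n≡m (gcd[m,n]∣n m k))) ⟩
      d ℕ.* ((k′ ℕ.* g) ℕ.* (k′ ℕ.* g))  ≡⟨ cong (d ℕ.*_) (ℕ-interchange k′ g k′ g) ⟩
      d ℕ.* ((k′ ℕ.* k′) ℕ.* (g ℕ.* g))  ≡⟨ ℕₚ.*-assoc d _ _ ⟨
      (d ℕ.* (k′ ℕ.* k′)) ℕ.* (g ℕ.* g)  ∎)
    k′∣m′ : k′ ∣ℕ m′
    k′∣m′ = coprime-divisor (coprime-sym (coprime-/gcd m k))
              (divides (d ℕ.* k′) (trans reduced (sym (ℕₚ.*-assoc d k′ k′))))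
    k′≡1 : k′ ≡ 1
    k′≡1 = coprime-/gcd m k (k′∣m′ , ∣-refl)

i*i≡+∣i∣² : ∀ i → i * i ≡ + (∣ i ∣ ℕ.* ∣ i ∣)
i*i≡+∣i∣² (+ n) = sym (ℤₚ.pos-* n n)
i*i≡+∣i∣² -[1+ n ] = refl

m²≡Dk²⇒IsSquare : ∀ {D m k} → k ≢ 0ℤ → m * m ≡ D * (k * k) → IsSquareℤ D
m²≡Dk²⇒IsSquare {+ d} {m} {k} k≢0 m²≡Dk² =
  lift (m²≡dk²⇒∃s²≡d (∣ m ∣) d (∣ k ∣) (k≢0 ∘ ℤₚ.∣i∣≡0⇒i≡0) ∣m∣²≡d∣k∣²)
  where
    open ≡-Reasoning
    lift : ∃[ s ] s ℕ.* s ≡ d → IsSquareℤ (+ d)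
    lift (s , s²≡d) = + s , trans (sym (ℤₚ.pos-* s s)) (cong +_ s²≡d)
    ∣m∣²≡d∣k∣² : ∣ m ∣ ℕ.* ∣ m ∣ ≡ d ℕ.* (∣ k ∣ ℕ.* ∣ k ∣)
    ∣m∣²≡d∣k∣² = begin
      ∣ m ∣ ℕ.* ∣ m ∣         ≡⟨ sym (ℤₚ.abs-* m m) ⟩
      ∣ m * m ∣               ≡⟨ cong ∣_∣ m²≡Dk² ⟩
      ∣ + d * (k * k) ∣       ≡⟨ ℤₚ.abs-* (+ d) (k * k) ⟩
      d ℕ.* ∣ k * k ∣         ≡⟨ cong (d ℕ.*_) (ℤₚ.abs-* k k) ⟩
      d ℕ.* (∣ k ∣ ℕ.* ∣ k ∣) ∎
m²≡Dk²⇒IsSquare { -[1+ _ ]} {m} {+[1+ _ ]} _ m²≡Dk² with trans (sym (i*i≡+∣i∣² m)) m²≡Dk²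
... | ()
m²≡Dk²⇒IsSquare { -[1+ _ ]} {m} { -[1+ _ ]} _ m²≡Dk² with trans (sym (i*i≡+∣i∣² m)) m²≡Dk²
... | ()
m²≡Dk²⇒IsSquare { -[1+ _ ]} {k = + 0} k≢0 _ = contradiction refl k≢0

isSquare? : ∀ D → Dec (IsSquareℤ D)
isSquare? (+ d) = map′ lift lower (ℕₚ.anyUpTo? (λ s → s ℕ.* s ℕₚ.≟ d) (suc d))
  where
    lift : ∃[ s ] s ℕ.< suc d × s ℕ.* s ≡ d → IsSquareℤ (+ d)
    lift (s , _ , s²≡d) = + s , trans (sym (ℤₚ.pos-* s s)) (cong +_ s²≡d)
    n≤n*n : ∀ n → n ℕ.≤ n ℕ.* n
    n≤n*n zero = ℕ.z≤n
    n≤n*n (suc n) = ℕₚ.m≤m*n (suc n) (suc n)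
    lower : IsSquareℤ (+ d) → ∃[ s ] s ℕ.< suc d × s ℕ.* s ≡ d
    lower (t , t²≡d) = ∣ t ∣ , ℕ.s≤s (subst (∣ t ∣ ℕ.≤_) ∣t∣²≡d (n≤n*n ∣ t ∣)) , ∣t∣²≡d
      where
        ∣t∣²≡d : ∣ t ∣ ℕ.* ∣ t ∣ ≡ d
        ∣t∣²≡d = trans (sym (ℤₚ.abs-* t t)) (cong ∣_∣ t²≡d)
isSquare? -[1+ n ] = no λ { (t , t²≡D) → negative (trans (sym (i*i≡+∣i∣² t)) t²≡D) }
  where
    negative : ∀ {m} → + m ≢ -[1+ n ]
    negative ()

record FermatSignature : Set₁ where
  infixl 6 _∔_
  field
    Carrier : Set
    _∔_ : Carrier → Carrier → Carrier
    _⊙_ : ℤ → Carrier → Carrier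
    _^_ : Carrier → ℕ → Carrier

  fermatˡ : ℤ → ℤ → ℕ → Carrier → Carrier → Carrier
  fermatˡ u v n x y = u ⊙ (x ^ n) ∔ v ⊙ (y ^ n)

  fermatʳ : ℤ → ℕ → Carrier → Carrier
  fermatʳ w n z = w ⊙ (z ^ n)

  Fermat : ℤ → ℤ → ℤ → ℕ → Carrier → Carrier → Carrier → Set
  Fermat u v w n x y z = fermatˡ u v n x y ≡ fermatʳ w n z

open FermatSignature using (Fermat)

module _ {S T : FermatSignature} where
  private
    module S = FermatSignature S
    module T = FermatSignature T

  record IsFermatHomomorphism (f : S.Carrier → T.Carrier) : Set where
    field
      ∔-homo : ∀ p q → f (p S.∔ q) ≡ f p T.∔ f q
      ⊙-homo : ∀ k p → f (k S.⊙ p) ≡ k T.⊙ f p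
      ^-homo : ∀ p n → f (p S.^ n) ≡ f p T.^ n

    fermatʳ-homo : ∀ w n z → f (S.fermatʳ w n z) ≡ T.fermatʳ w n (f z)
    fermatʳ-homo w n z = trans (⊙-homo w _) (cong (w T.⊙_) (^-homo z n))

    fermatˡ-homo : ∀ u v n x y → f (S.fermatˡ u v n x y) ≡ T.fermatˡ u v n (f x) (f y)
    fermatˡ-homo u v n x y = trans (∔-homo _ _) (cong₂ T._∔_ (fermatʳ-homo u n x) (fermatʳ-homo v n y))

    fermat-image : ∀ u v w n {x y z} → S.Fermat u v w n x y z → T.Fermat u v w n (f x) (f y) (f z)
    fermat-image u v w n {x} {y} {z} eq =
      trans (sym (fermatˡ-homo u v n x y)) (trans (cong f eq) (fermatʳ-homo w n z))

    fermat-preimage : Injective _≡_ _≡_ f → ∀ u v w n {x y z x′ y′ z′} →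
      f x ≡ x′ → f y ≡ y′ → f z ≡ z′ → T.Fermat u v w n x′ y′ z′ → S.Fermat u v w n x y z
    fermat-preimage f-injective u v w n {x} {y} {z} refl refl refl eq =
      f-injective (trans (fermatˡ-homo u v n x y) (trans eq (sym (fermatʳ-homo w n z))))

module _ (S : FermatSignature) where
  open FermatSignature S hiding (Fermat)

  record IsScalable : Set where
    field
      ⊙-distrib : ∀ k p q → k ⊙ (p ∔ q) ≡ k ⊙ p ∔ k ⊙ q
      ⊙-comm : ∀ k l p → k ⊙ (l ⊙ p) ≡ l ⊙ (k ⊙ p)
      ⊙-^ : ∀ k p n → (k ⊙ p) ^ n ≡ (k ^ℤ n) ⊙ (p ^ n)

    fermat-scale : ∀ t u v w n {x y z} → Fermat S u v w n x y z →
      Fermat S u v w n (t ⊙ x) (t ⊙ y) (t ⊙ z)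
    fermat-scale t u v w n {x} {y} {z} eq = begin
      u ⊙ ((t ⊙ x) ^ n) ∔ v ⊙ ((t ⊙ y) ^ n)       ≡⟨ cong₂ _∔_ (pull u x) (pull v y) ⟩
      tⁿ ⊙ (u ⊙ (x ^ n)) ∔ tⁿ ⊙ (v ⊙ (y ^ n))     ≡⟨ sym (⊙-distrib tⁿ _ _) ⟩
      tⁿ ⊙ (u ⊙ (x ^ n) ∔ v ⊙ (y ^ n))           ≡⟨ cong (tⁿ ⊙_) eq ⟩
      tⁿ ⊙ (w ⊙ (z ^ n))                          ≡⟨ sym (pull w z) ⟩
      w ⊙ ((t ⊙ z) ^ n)                           ∎
      where
        open ≡-Reasoning
        tⁿ = t ^ℤ n
        pull : ∀ k p → k ⊙ ((t ⊙ p) ^ n) ≡ tⁿ ⊙ (k ⊙ (p ^ n))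
        pull k p = trans (cong (k ⊙_) (⊙-^ t p n)) (⊙-comm k tⁿ (p ^ n))

ℤ-signature : FermatSignature
ℤ-signature = record { Carrier = ℤ ; _∔_ = _+_ ; _⊙_ = _*_ ; _^_ = _^ℤ_ }

IntegerSolvable : ℤ → ℤ → ℤ → ℕ → Set
IntegerSolvable u v w n =
  ∃[ x ] ∃[ y ] ∃[ z ] ¬ (x * (y * z) ≡ + 0) × Fermat ℤ-signature u v w n x y z

M2-signature : FermatSignature
M2-signature = record { Carrier = M2 ; _∔_ = _⊕_ ; _⊙_ = _⊛_ ; _^_ = _^M_ }

mat-cong : ∀ {p q r s p′ q′ r′ s′} → p ≡ p′ → q ≡ q′ → r ≡ r′ → s ≡ s′ →
  mat p q r s ≡ mat p′ q′ r′ s′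
mat-cong refl refl refl refl = refl

⊛-distrib-⊕ : ∀ k X Y → k ⊛ (X ⊕ Y) ≡ (k ⊛ X) ⊕ (k ⊛ Y)
⊛-distrib-⊕ k (mat p q r s) (mat p′ q′ r′ s′) =
  mat-cong (ℤₚ.*-distribˡ-+ k p p′) (ℤₚ.*-distribˡ-+ k q q′)
           (ℤₚ.*-distribˡ-+ k r r′) (ℤₚ.*-distribˡ-+ k s s′)

⊛-comm : ∀ k l X → k ⊛ (l ⊛ X) ≡ l ⊛ (k ⊛ X)
⊛-comm k l (mat p q r s) = mat-cong (swap p) (swap q) (swap r) (swap s)
  where
    swap : ∀ x → k * (l * x) ≡ l * (k * x)
    swap = ℤ-x∙yz≈y∙xz k l

⊛-· : ∀ k l X Y → (k ⊛ X) · (l ⊛ Y) ≡ (k * l) ⊛ (X · Y)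
⊛-· k l (mat p q r s) (mat p′ q′ r′ s′) =
  mat-cong (entry p q p′ r′) (entry p q q′ s′) (entry r s p′ r′) (entry r s q′ s′)
  where
    entry : ∀ x y x′ y′ → (k * x) * (l * x′) + (k * y) * (l * y′) ≡ (k * l) * (x * x′ + y * y′)
    entry x y x′ y′ = solve (k ∷ l ∷ x ∷ y ∷ x′ ∷ y′ ∷ [])

⊛-^M : ∀ k X n → (k ⊛ X) ^M n ≡ (k ^ℤ n) ⊛ (X ^M n)
⊛-^M k X zero = refl
⊛-^M k X (suc n) = trans (cong ((k ⊛ X) ·_) (⊛-^M k X n)) (⊛-· k (k ^ℤ n) X (X ^M n))

det-⊛ : ∀ k X → det (k ⊛ X) ≡ (k * k) * det X
det-⊛ k (mat p q r s) = expand
  where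
    expand : (k * p) * (k * s) - (k * q) * (k * r) ≡ (k * k) * (p * s - q * r)
    expand = solve (k ∷ p ∷ q ∷ r ∷ s ∷ [])

M2-scalable : IsScalable M2-signature
M2-scalable = record { ⊙-distrib = ⊛-distrib-⊕ ; ⊙-comm = ⊛-comm ; ⊙-^ = ⊛-^M }

module QuadraticOrder (D : ℤ) where

  ℤ[√D] : Set
  ℤ[√D] = ℤ × ℤ

  0ᴰ 1ᴰ : ℤ[√D]
  0ᴰ = (+ 0 , + 0)
  1ᴰ = (+ 1 , + 0)

  fromℤ : ℤ → ℤ[√D]
  fromℤ m = (m , + 0)

  infixl 6 _+ᴰ_
  infixl 7 _*ᴰ_

  _+ᴰ_ : ℤ[√D] → ℤ[√D] → ℤ[√D]
  (m , k) +ᴰ (n , l) = (m + n , k + l)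

  _*ᴰ_ : ℤ[√D] → ℤ[√D] → ℤ[√D]
  (m , k) *ᴰ (n , l) = (m * n + D * (k * l) , m * l + k * n)

  _⊙ᴰ_ : ℤ → ℤ[√D] → ℤ[√D]
  t ⊙ᴰ (m , k) = (t * m , t * k)

  _^ᴰ_ : ℤ[√D] → ℕ → ℤ[√D]
  x ^ᴰ zero = 1ᴰ
  x ^ᴰ suc n = x *ᴰ (x ^ᴰ n)

  norm : ℤ[√D] → ℤ
  norm (m , k) = m * m - D * (k * k)

  norm-0ᴰ : norm 0ᴰ ≡ 0ℤ
  norm-0ᴰ = cong (λ t → 0ℤ - t) (ℤₚ.*-zeroʳ D)

  evalMonicᴰ : List ℤ → ℤ[√D] → ℤ[√D]
  evalMonicᴰ [] x = 1ᴰ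
  evalMonicᴰ (c ∷ cs) x = fromℤ c +ᴰ x *ᴰ evalMonicᴰ cs x

  charPoly : ℤ[√D] → List ℤ
  charPoly (m , k) = norm (m , k) ∷ - (+ 2 * m) ∷ []

  charPoly-root : ∀ x → evalMonicᴰ (charPoly x) x ≡ 0ᴰ
  charPoly-root (m , k) = cong₂ _,_ root₁ root₂
    where
      root₁ : (m * m - D * (k * k))
                + (m * (- (+ 2 * m) + (m * + 1 + D * (k * + 0)))
                   + D * (k * (+ 0 + (m * + 0 + k * + 1)))) ≡ + 0
      root₁ = solve (D ∷ m ∷ k ∷ [])
      root₂ : + 0 + (m * (+ 0 + (m * + 0 + k * + 1))
                     + k * (- (+ 2 * m) + (m * + 1 + D * (k * + 0)))) ≡ + 0
      root₂ = solve (D ∷ m ∷ k ∷ [])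

  signature : FermatSignature
  signature = record { Carrier = ℤ[√D] ; _∔_ = _+ᴰ_ ; _⊙_ = _⊙ᴰ_ ; _^_ = _^ᴰ_ }

  record Solvable (u v w : ℤ) (n : ℕ) : Set where
    constructor solution
    field
      x y z : ℤ[√D]
      norm≢0 : norm (x *ᴰ (y *ᴰ z)) ≢ 0ℤ
      fermat : Fermat signature u v w n x y z

  fromℤ-*ᴰ : ∀ m n → fromℤ (m * n) ≡ fromℤ m *ᴰ fromℤ n
  fromℤ-*ᴰ m n = cong₂ _,_ (sym first) (sym second)
    where
      first : m * n + D * (+ 0 * + 0) ≡ m * n
      first = solve (D ∷ m ∷ n ∷ [])
      second : m * + 0 + + 0 * n ≡ + 0
      second = solve (m ∷ n ∷ [])

  fromℤ-isFermatHomomorphism : IsFermatHomomorphism {ℤ-signature} {signature} fromℤ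
  fromℤ-isFermatHomomorphism = record
    { ∔-homo = λ _ _ → refl
    ; ⊙-homo = λ k m → cong (k * m ,_) (sym (ℤₚ.*-zeroʳ k))
    ; ^-homo = fromℤ-^
    }
    where
      fromℤ-^ : ∀ m n → fromℤ (m ^ℤ n) ≡ fromℤ m ^ᴰ n
      fromℤ-^ m zero = refl
      fromℤ-^ m (suc n) = trans (fromℤ-*ᴰ m (m ^ℤ n)) (cong (fromℤ m *ᴰ_) (fromℤ-^ m n))

  norm-fromℤ : ∀ m → norm (fromℤ m) ≡ m * m
  norm-fromℤ m = expand
    where
      expand : m * m - D * (+ 0 * + 0) ≡ m * m
      expand = solve (D ∷ m ∷ [])

  evalAt : ℤ → ℤ[√D] → ℤ
  evalAt s (m , k) = m + k * s

  module _ (s : ℤ) (s²≡D : s * s ≡ D) where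

    evalAt-*ᴰ : ∀ x y → evalAt s (x *ᴰ y) ≡ evalAt s x * evalAt s y
    evalAt-*ᴰ (m , k) (n , l) rewrite sym s²≡D = expand
      where
        expand : m * n + s * s * (k * l) + (m * l + k * n) * s ≡ (m + k * s) * (n + l * s)
        expand = solve (s ∷ m ∷ k ∷ n ∷ l ∷ [])

    evalAt-isFermatHomomorphism : IsFermatHomomorphism {signature} {ℤ-signature} (evalAt s)
    evalAt-isFermatHomomorphism = record
      { ∔-homo = evalAt-+ᴰ
      ; ⊙-homo = evalAt-⊙ᴰ
      ; ^-homo = evalAt-^
      }
      where
        evalAt-+ᴰ : ∀ x y → evalAt s (x +ᴰ y) ≡ evalAt s x + evalAt s y
        evalAt-+ᴰ (m , k) (n , l) = expand
          where
            expand : m + n + (k + l) * s ≡ m + k * s + (n + l * s)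
            expand = solve (s ∷ m ∷ k ∷ n ∷ l ∷ [])
        evalAt-⊙ᴰ : ∀ t x → evalAt s (t ⊙ᴰ x) ≡ t * evalAt s x
        evalAt-⊙ᴰ t (m , k) = expand
          where
            expand : t * m + t * k * s ≡ t * (m + k * s)
            expand = solve (s ∷ t ∷ m ∷ k ∷ [])
        evalAt-^ : ∀ x n → evalAt s (x ^ᴰ n) ≡ evalAt s x ^ℤ n
        evalAt-^ x zero = refl
        evalAt-^ x (suc n) = trans (evalAt-*ᴰ x (x ^ᴰ n)) (cong (evalAt s x *_) (evalAt-^ x n))

    norm-evalAt : ∀ x → norm x ≡ evalAt s x * evalAt (- s) x
    norm-evalAt (m , k) rewrite sym s²≡D = expand
      where
        expand : m * m - s * s * (k * k) ≡ (m + k * s) * (m + k * - s)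
        expand = solve (s ∷ m ∷ k ∷ [])

    solvable⇒integerSolvable : ∀ {u v w n} → Solvable u v w n → IntegerSolvable u v w n
    solvable⇒integerSolvable {u} {v} {w} {n} (solution x y z norm≢0 eq) =
      evalAt s x , evalAt s y , evalAt s z , product≢0 , fermat-image u v w n eq
      where
        open IsFermatHomomorphism evalAt-isFermatHomomorphism using (fermat-image)
        product≢0 : evalAt s x * (evalAt s y * evalAt s z) ≢ 0ℤ
        product≢0 p≡0 = norm≢0 (begin
          norm (x *ᴰ (y *ᴰ z))                                      ≡⟨ norm-evalAt (x *ᴰ (y *ᴰ z)) ⟩
          evalAt s (x *ᴰ (y *ᴰ z)) * evalAt (- s) (x *ᴰ (y *ᴰ z))  ≡⟨ cong (_* evalAt (- s) (x *ᴰ (y *ᴰ z))) evalAt≡0 ⟩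
          0ℤ                                                        ∎)
          where
            open ≡-Reasoning
            evalAt≡0 : evalAt s (x *ᴰ (y *ᴰ z)) ≡ 0ℤ
            evalAt≡0 = trans (evalAt-*ᴰ x (y *ᴰ z)) (trans (cong (evalAt s x *_) (evalAt-*ᴰ y z)) p≡0)

  integerSolvable⇒solvable : ∀ {u v w n} → IntegerSolvable u v w n → Solvable u v w n
  integerSolvable⇒solvable {u} {v} {w} {n} (x , y , z , product≢0 , eq) =
    solution (fromℤ x) (fromℤ y) (fromℤ z) norm≢0 (fermat-image u v w n eq)
    where
      open IsFermatHomomorphism fromℤ-isFermatHomomorphism using (fermat-image)
      product : fromℤ x *ᴰ (fromℤ y *ᴰ fromℤ z) ≡ fromℤ (x * (y * z))
      product = sym (trans (fromℤ-*ᴰ x (y * z)) (cong (fromℤ x *ᴰ_) (fromℤ-*ᴰ y z)))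
      norm≢0 : norm (fromℤ x *ᴰ (fromℤ y *ᴰ fromℤ z)) ≢ 0ℤ
      norm≢0 = *-≢0 {x * (y * z)} product≢0 product≢0 ∘ trans (sym (trans (cong norm product) (norm-fromℤ (x * (y * z)))))

  norm≡0⇒≡0ᴰ : ¬ IsSquareℤ D → ∀ x → norm x ≡ 0ℤ → x ≡ 0ᴰ
  norm≡0⇒≡0ᴰ ¬square (m , k) norm≡0 with k ℤₚ.≟ 0ℤ
  ... | no k≢0 = contradiction (m²≡Dk²⇒IsSquare {m = m} k≢0 (ℤₚ.i-j≡0⇒i≡j (m * m) (D * (k * k)) norm≡0)) ¬square
  ... | yes refl = cong (_, 0ℤ) ([ id , id ]′ (ℤₚ.i*j≡0⇒i≡0∨j≡0 m m²≡0))
    where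
      m²≡0 : m * m ≡ 0ℤ
      m²≡0 = trans (ℤₚ.i-j≡0⇒i≡j (m * m) (D * 0ℤ) norm≡0) (ℤₚ.*-zeroʳ D)

module Centraliser (a b c : ℤ) where

  A : M2
  A = mat a b c (+ 0)

  open QuadraticOrder (a * a + + 4 * (b * c))

  -- m·I + k·(2A − a·I)
  toMatrix : ℤ[√D] → M2
  toMatrix (m , k) = mat (m + k * a) (k * (+ 2 * b)) (k * (+ 2 * c)) (m - k * a)

  toℤ[√D] : M2 → ℤ[√D]
  toℤ[√D] (mat p q r s) = (b * (p + s) , q)

  toMatrix-+ᴰ : ∀ x y → toMatrix (x +ᴰ y) ≡ toMatrix x ⊕ toMatrix y
  toMatrix-+ᴰ (m , k) (n , l) = mat-cong diagonal (ℤₚ.*-distribʳ-+ (+ 2 * b) k l)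
                                          (ℤₚ.*-distribʳ-+ (+ 2 * c) k l) antidiagonal
    where
      diagonal : m + n + (k + l) * a ≡ m + k * a + (n + l * a)
      diagonal = solve (a ∷ m ∷ k ∷ n ∷ l ∷ [])
      antidiagonal : m + n - (k + l) * a ≡ m - k * a + (n - l * a)
      antidiagonal = solve (a ∷ m ∷ k ∷ n ∷ l ∷ [])

  toMatrix-⊙ᴰ : ∀ t x → toMatrix (t ⊙ᴰ x) ≡ t ⊛ toMatrix x
  toMatrix-⊙ᴰ t (m , k) = mat-cong e₁₁ (ℤₚ.*-assoc t k (+ 2 * b)) (ℤₚ.*-assoc t k (+ 2 * c)) e₂₂
    where
      e₁₁ : t * m + t * k * a ≡ t * (m + k * a)
      e₁₁ = solve (a ∷ t ∷ m ∷ k ∷ [])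
      e₂₂ : t * m - t * k * a ≡ t * (m - k * a)
      e₂₂ = solve (a ∷ t ∷ m ∷ k ∷ [])

  toMatrix-*ᴰ : ∀ x y → toMatrix (x *ᴰ y) ≡ toMatrix x · toMatrix y
  toMatrix-*ᴰ (m , k) (n , l) = mat-cong e₁₁ e₁₂ e₂₁ e₂₂
    where
      e₁₁ : m * n + (a * a + + 4 * (b * c)) * (k * l) + (m * l + k * n) * a
          ≡ (m + k * a) * (n + l * a) + k * (+ 2 * b) * (l * (+ 2 * c))
      e₁₁ = solve (a ∷ b ∷ c ∷ m ∷ k ∷ n ∷ l ∷ [])
      e₁₂ : (m * l + k * n) * (+ 2 * b) ≡ (m + k * a) * (l * (+ 2 * b)) + k * (+ 2 * b) * (n - l * a)
      e₁₂ = solve (a ∷ b ∷ m ∷ k ∷ n ∷ l ∷ [])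
      e₂₁ : (m * l + k * n) * (+ 2 * c) ≡ k * (+ 2 * c) * (n + l * a) + (m - k * a) * (l * (+ 2 * c))
      e₂₁ = solve (a ∷ c ∷ m ∷ k ∷ n ∷ l ∷ [])
      e₂₂ : m * n + (a * a + + 4 * (b * c)) * (k * l) - (m * l + k * n) * a
          ≡ k * (+ 2 * c) * (l * (+ 2 * b)) + (m - k * a) * (n - l * a)
      e₂₂ = solve (a ∷ b ∷ c ∷ m ∷ k ∷ n ∷ l ∷ [])

  toMatrix-^ᴰ : ∀ x n → toMatrix (x ^ᴰ n) ≡ toMatrix x ^M n
  toMatrix-^ᴰ x zero = refl
  toMatrix-^ᴰ x (suc n) = trans (toMatrix-*ᴰ x (x ^ᴰ n)) (cong (toMatrix x ·_) (toMatrix-^ᴰ x n))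

  toMatrix-isFermatHomomorphism : IsFermatHomomorphism {signature} {M2-signature} toMatrix
  toMatrix-isFermatHomomorphism =
    record { ∔-homo = toMatrix-+ᴰ ; ⊙-homo = toMatrix-⊙ᴰ ; ^-homo = toMatrix-^ᴰ }

  toMatrix-triple : ∀ x y z → toMatrix (x *ᴰ (y *ᴰ z)) ≡ toMatrix x · (toMatrix y · toMatrix z)
  toMatrix-triple x y z = trans (toMatrix-*ᴰ x (y *ᴰ z)) (cong (toMatrix x ·_) (toMatrix-*ᴰ y z))

  det-toMatrix : ∀ x → det (toMatrix x) ≡ norm x
  det-toMatrix (m , k) = expand
    where
      expand : (m + k * a) * (m - k * a) - k * (+ 2 * b) * (k * (+ 2 * c))
             ≡ m * m - (a * a + + 4 * (b * c)) * (k * k)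
      expand = solve (a ∷ b ∷ c ∷ m ∷ k ∷ [])

  toMatrix∈C : ∀ x → InC A (toMatrix x)
  toMatrix∈C (m , k) = mat-cong e₁₁ e₁₂ e₂₁ e₂₂
    where
      e₁₁ : a * (m + k * a) + b * (k * (+ 2 * c)) ≡ (m + k * a) * a + k * (+ 2 * b) * c
      e₁₁ = solve (a ∷ b ∷ c ∷ m ∷ k ∷ [])
      e₁₂ : a * (k * (+ 2 * b)) + b * (m - k * a) ≡ (m + k * a) * b + k * (+ 2 * b) * + 0
      e₁₂ = solve (a ∷ b ∷ m ∷ k ∷ [])
      e₂₁ : c * (m + k * a) + + 0 * (k * (+ 2 * c)) ≡ k * (+ 2 * c) * a + (m - k * a) * c
      e₂₁ = solve (a ∷ c ∷ m ∷ k ∷ [])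
      e₂₂ : c * (k * (+ 2 * b)) + + 0 * (m - k * a) ≡ k * (+ 2 * c) * b + (m - k * a) * + 0
      e₂₂ = solve (a ∷ b ∷ c ∷ m ∷ k ∷ [])

  toMatrix-injective : b ≢ 0ℤ → Injective _≡_ _≡_ toMatrix
  toMatrix-injective b≢0 {m , k} {n , l} eq = cong₂ _,_ m≡n k≡l
    where
      open ≡-Reasoning
      k≡l : k ≡ l
      k≡l = ℤₚ.*-cancelʳ-≡ k l (+ 2 * b) {{≢-nonZero (*-≢0 {+ 2} (λ ()) b≢0)}} (cong m12 eq)
      m≡n : m ≡ n
      m≡n = begin
        m                  ≡⟨ solve (a ∷ m ∷ k ∷ []) ⟩
        m + k * a - k * a  ≡⟨ cong₂ (λ i j → i - j * a) (cong m11 eq) k≡l ⟩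
        n + l * a - l * a  ≡⟨ solve (a ∷ n ∷ l ∷ []) ⟩
        n                  ∎

  toMatrix-toℤ[√D] : ∀ B → InC A B → toMatrix (toℤ[√D] B) ≡ (+ 2 * b) ⊛ B
  toMatrix-toℤ[√D] (mat p q r s) AB≡BA = mat-cong e₁₁ (ℤₚ.*-comm q (+ 2 * b)) e₂₁ e₂₂
    where
      open ≡-Reasoning
      top-left : a * p + b * r ≡ p * a + q * c
      top-left = cong m11 AB≡BA
      top-right : a * q + b * s ≡ p * b + q * + 0
      top-right = cong m12 AB≡BA
      e₁₁ : b * (p + s) + q * a ≡ + 2 * b * p
      e₁₁ = begin
        b * (p + s) + q * a        ≡⟨ solve (a ∷ b ∷ p ∷ q ∷ s ∷ []) ⟩
        b * p + (a * q + b * s)    ≡⟨ cong (λ i → b * p + i) top-right ⟩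
        b * p + (p * b + q * + 0)  ≡⟨ solve (b ∷ p ∷ q ∷ []) ⟩
        + 2 * b * p                ∎
      e₂₁ : q * (+ 2 * c) ≡ + 2 * b * r
      e₂₁ = begin
        q * (+ 2 * c)                          ≡⟨ solve (a ∷ c ∷ p ∷ q ∷ []) ⟩
        + 2 * (p * a + q * c) - + 2 * (a * p)  ≡⟨ cong (λ i → + 2 * i - + 2 * (a * p)) top-left ⟨
        + 2 * (a * p + b * r) - + 2 * (a * p)  ≡⟨ solve (a ∷ b ∷ p ∷ r ∷ []) ⟩
        + 2 * b * r                            ∎
      e₂₂ : b * (p + s) - q * a ≡ + 2 * b * s
      e₂₂ = begin
        b * (p + s) - q * a              ≡⟨ solve (a ∷ b ∷ p ∷ q ∷ s ∷ []) ⟩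
        p * b + q * + 0 + b * s - q * a  ≡⟨ cong (λ i → i + b * s - q * a) top-right ⟨
        a * q + b * s + b * s - q * a    ≡⟨ solve (a ∷ b ∷ q ∷ s ∷ []) ⟩
        + 2 * b * s                      ∎

  solvable⇒matrixSolvable : ∀ {u v w n} → Solvable u v w n → MatrixSolvable A u v w n
  solvable⇒matrixSolvable {u} {v} {w} {n} (solution x y z norm≢0 eq) =
    toMatrix x , toMatrix y , toMatrix z , toMatrix∈C x , toMatrix∈C y , toMatrix∈C z ,
    det≢0 , fermat-image u v w n eq
    where
      open IsFermatHomomorphism toMatrix-isFermatHomomorphism using (fermat-image)
      det≢0 : det (toMatrix x · (toMatrix y · toMatrix z)) ≢ 0ℤ
      det≢0 = norm≢0 ∘ trans (sym (det-toMatrix (x *ᴰ (y *ᴰ z)))) ∘ trans (cong det (toMatrix-triple x y z))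

  matrixSolvable⇒solvable : b ≢ 0ℤ → ∀ {u v w n} → MatrixSolvable A u v w n → Solvable u v w n
  matrixSolvable⇒solvable b≢0 {u} {v} {w} {n} (X , Y , Z , X∈C , Y∈C , Z∈C , det≢0 , eq) =
    solution x y z norm≢0
      (fermat-preimage (toMatrix-injective b≢0) u v w n (toMatrix-toℤ[√D] X X∈C) (toMatrix-toℤ[√D] Y Y∈C)
        (toMatrix-toℤ[√D] Z Z∈C) (IsScalable.fermat-scale M2-scalable t u v w n eq))
    where
      open IsFermatHomomorphism toMatrix-isFermatHomomorphism using (fermat-preimage)
      open ≡-Reasoning
      t = + 2 * b
      x = toℤ[√D] X
      y = toℤ[√D] Y
      z = toℤ[√D] Z
      t³ = t * (t * t)
      norm-product : norm (x *ᴰ (y *ᴰ z)) ≡ (t³ * t³) * det (X · (Y · Z))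
      norm-product = begin
        norm (x *ᴰ (y *ᴰ z))                          ≡⟨ det-toMatrix (x *ᴰ (y *ᴰ z)) ⟨
        det (toMatrix (x *ᴰ (y *ᴰ z)))                ≡⟨ cong det (toMatrix-triple x y z) ⟩
        det (toMatrix x · (toMatrix y · toMatrix z))  ≡⟨ cong det (cong₂ _·_ (toMatrix-toℤ[√D] X X∈C)
                                                           (cong₂ _·_ (toMatrix-toℤ[√D] Y Y∈C) (toMatrix-toℤ[√D] Z Z∈C))) ⟩
        det ((t ⊛ X) · ((t ⊛ Y) · (t ⊛ Z)))           ≡⟨ cong (λ M → det ((t ⊛ X) · M)) (⊛-· t t Y Z) ⟩
        det ((t ⊛ X) · ((t * t) ⊛ (Y · Z)))           ≡⟨ cong det (⊛-· t (t * t) X (Y · Z)) ⟩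
        det (t³ ⊛ (X · (Y · Z)))                      ≡⟨ det-⊛ t³ (X · (Y · Z)) ⟩
        (t³ * t³) * det (X · (Y · Z))                 ∎
      t≢0 : t ≢ 0ℤ
      t≢0 = *-≢0 {+ 2} (λ ()) b≢0
      t³≢0 : t³ ≢ 0ℤ
      t³≢0 = *-≢0 {t} t≢0 (*-≢0 {t} t≢0 t≢0)
      norm≢0 : norm (x *ᴰ (y *ᴰ z)) ≢ 0ℤ
      norm≢0 = *-≢0 {t³ * t³} (*-≢0 {t³} t³≢0 t³≢0) det≢0 ∘ trans (sym norm-product)

ι : ℤ → ℚ
ι k = k ℚ./ 1

toℚᵘ-ι : ∀ k → ℚ.toℚᵘ (ι k) ℚᵘ.≃ mkℚᵘ k 0
toℚᵘ-ι k = ℚₚ.toℚᵘ-fromℚᵘ (mkℚᵘ k 0)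

ι-+ : ∀ k l → ι (k + l) ≡ ι k ℚ.+ ι l
ι-+ k l = ℚₚ.toℚᵘ-injective (begin
  ℚ.toℚᵘ (ι (k + l))                ≈⟨ toℚᵘ-ι (k + l) ⟩
  mkℚᵘ (k + l) 0                     ≈⟨ *≡* numerators ⟩
  mkℚᵘ k 0 ℚᵘ.+ mkℚᵘ l 0             ≈⟨ ℚᵘₚ.+-cong (toℚᵘ-ι k) (toℚᵘ-ι l) ⟨
  ℚ.toℚᵘ (ι k) ℚᵘ.+ ℚ.toℚᵘ (ι l)     ≈⟨ ℚₚ.toℚᵘ-homo-+ (ι k) (ι l) ⟨
  ℚ.toℚᵘ (ι k ℚ.+ ι l)               ∎)
  where
    open ℚᵘₚ.≃-Reasoning
    numerators : (k + l) * + 1 ≡ (k * + 1 + l * + 1) * + 1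
    numerators = solve (k ∷ l ∷ [])

ι-* : ∀ k l → ι (k * l) ≡ ι k ℚ.* ι l
ι-* k l = ℚₚ.toℚᵘ-injective (begin
  ℚ.toℚᵘ (ι (k * l))                ≈⟨ toℚᵘ-ι (k * l) ⟩
  mkℚᵘ k 0 ℚᵘ.* mkℚᵘ l 0             ≈⟨ ℚᵘₚ.*-cong (toℚᵘ-ι k) (toℚᵘ-ι l) ⟨
  ℚ.toℚᵘ (ι k) ℚᵘ.* ℚ.toℚᵘ (ι l)     ≈⟨ ℚₚ.toℚᵘ-homo-* (ι k) (ι l) ⟨
  ℚ.toℚᵘ (ι k ℚ.* ι l)               ∎)
  where open ℚᵘₚ.≃-Reasoning

ι-injective : Injective _≡_ _≡_ ι
ι-injective {k} {l} ιk≡ιl with k≃l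
  where
    open ℚᵘₚ.≃-Reasoning
    k≃l : mkℚᵘ k 0 ℚᵘ.≃ mkℚᵘ l 0
    k≃l = begin
      mkℚᵘ k 0        ≈⟨ toℚᵘ-ι k ⟨
      ℚ.toℚᵘ (ι k)    ≡⟨ cong ℚ.toℚᵘ ιk≡ιl ⟩
      ℚ.toℚᵘ (ι l)    ≈⟨ toℚᵘ-ι l ⟩
      mkℚᵘ l 0        ∎
... | *≡* k*1≡l*1 = trans (sym (ℤₚ.*-identityʳ k)) (trans k*1≡l*1 (ℤₚ.*-identityʳ l))

ι*p≡0⇒p≡0 : ∀ {k} p → k ≢ 0ℤ → ι k ℚ.* p ≡ 0ℚ → p ≡ 0ℚ
ι*p≡0⇒p≡0 {k} p@(mkℚ n _ _) k≢0 ιk*p≡0 with kn≃0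
  where
    open ℚᵘₚ.≃-Reasoning
    kn≃0 : mkℚᵘ k 0 ℚᵘ.* ℚ.toℚᵘ p ℚᵘ.≃ ℚ.toℚᵘ 0ℚ
    kn≃0 = begin
      mkℚᵘ k 0 ℚᵘ.* ℚ.toℚᵘ p      ≈⟨ ℚᵘₚ.*-congʳ (toℚᵘ-ι k) ⟨
      ℚ.toℚᵘ (ι k) ℚᵘ.* ℚ.toℚᵘ p  ≈⟨ ℚₚ.toℚᵘ-homo-* (ι k) p ⟨
      ℚ.toℚᵘ (ι k ℚ.* p)          ≡⟨ cong ℚ.toℚᵘ ιk*p≡0 ⟩
      ℚ.toℚᵘ 0ℚ                   ∎
... | *≡* kn*1≡0 = ℚₚ.↥p≡0⇒p≡0 p ([ (λ k≡0 → contradiction k≡0 k≢0) , id ]′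
                    (ℤₚ.i*j≡0⇒i≡0∨j≡0 k (trans (sym (ℤₚ.*-identityʳ (k * n))) kn*1≡0)))

ι↧p*p≡ι↥p : ∀ p → ι (↧ p) ℚ.* p ≡ ι (↥ p)
ι↧p*p≡ι↥p p@(mkℚ n d-1 _) = ℚₚ.toℚᵘ-injective (begin
  ℚ.toℚᵘ (ι (↧ p) ℚ.* p)           ≈⟨ ℚₚ.toℚᵘ-homo-* (ι (↧ p)) p ⟩
  ℚ.toℚᵘ (ι (↧ p)) ℚᵘ.* ℚ.toℚᵘ p   ≈⟨ ℚᵘₚ.*-congʳ (toℚᵘ-ι (↧ p)) ⟩
  mkℚᵘ (↧ p) 0 ℚᵘ.* mkℚᵘ n d-1     ≈⟨ *≡* cross ⟩
  mkℚᵘ n 0                          ≈⟨ toℚᵘ-ι n ⟨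
  ℚ.toℚᵘ (ι n)                      ∎)
  where
    open ℚᵘₚ.≃-Reasoning
    cross : (+ suc d-1 * n) * + 1 ≡ n * + suc (d-1 ℕ.+ 0)
    cross = trans (ℤₚ.*-identityʳ _)
              (trans (ℤₚ.*-comm (+ suc d-1) n) (cong (λ j → n * + suc j) (sym (ℕₚ.+-identityʳ d-1))))

ι[m*↧p]*p≡ι[m*↥p] : ∀ m p → ι (m * ↧ p) ℚ.* p ≡ ι (m * ↥ p)
ι[m*↧p]*p≡ι[m*↥p] m p = begin
  ι (m * ↧ p) ℚ.* p        ≡⟨ cong (ℚ._* p) (ι-* m (↧ p)) ⟩
  ι m ℚ.* ι (↧ p) ℚ.* p    ≡⟨ ℚₚ.*-assoc (ι m) (ι (↧ p)) p ⟩
  ι m ℚ.* (ι (↧ p) ℚ.* p)  ≡⟨ cong (ι m ℚ.*_) (ι↧p*p≡ι↥p p) ⟩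
  ι m ℚ.* ι (↥ p)          ≡⟨ ι-* m (↥ p) ⟨
  ι (m * ↥ p)              ∎
  where open ≡-Reasoning

module QuadraticField (D : ℤ) where
  open QuadField D
  open QuadraticOrder D

  K-signature : FermatSignature
  K-signature = record { Carrier = K ; _∔_ = _+K_ ; _⊙_ = λ k x → ιK k *K x ; _^_ = _^K_ }

  KSolvable : ℤ → ℤ → ℤ → ℕ → Set
  KSolvable u v w n =
    ∃[ x ] ∃[ y ] ∃[ z ] InOK x × InOK y × InOK z × ¬ (x *K (y *K z) ≡ 0K) ×
      Fermat K-signature u v w n x y z

  infixr 7 _•_

  _•_ : ℚ → K → K
  q • (x₁ , x₂) = (q ℚ.* x₁ , q ℚ.* x₂)

  ιK*K≡• : ∀ k x → ιK k *K x ≡ ι k • x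
  ιK*K≡• k (x₁ , x₂) = cong₂ _,_ (first (ι k) Dℚ x₁ x₂) (second (ι k) x₁ x₂)
    where
      open ℚ-Solver renaming (solve to ℚ-solve)
      first : ∀ q d x₁ x₂ → q ℚ.* x₁ ℚ.+ d ℚ.* (0ℚ ℚ.* x₂) ≡ q ℚ.* x₁
      first = ℚ-solve 4 (λ q d x₁ x₂ → q :* x₁ :+ d :* (con 0ℚ :* x₂) := q :* x₁) refl
      second : ∀ q x₁ x₂ → q ℚ.* x₂ ℚ.+ 0ℚ ℚ.* x₁ ≡ q ℚ.* x₂
      second = ℚ-solve 3 (λ q x₁ x₂ → q :* x₂ :+ con 0ℚ :* x₁ := q :* x₂) refl

  •-distrib : ∀ q x y → q • (x +K y) ≡ (q • x) +K (q • y)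
  •-distrib q (x₁ , x₂) (y₁ , y₂) = cong₂ _,_ (ℚₚ.*-distribˡ-+ q x₁ y₁) (ℚₚ.*-distribˡ-+ q x₂ y₂)

  •-assoc : ∀ p q x → p • q • x ≡ (p ℚ.* q) • x
  •-assoc p q (x₁ , x₂) = cong₂ _,_ (sym (ℚₚ.*-assoc p q x₁)) (sym (ℚₚ.*-assoc p q x₂))

  •-*K : ∀ p q x y → (p • x) *K (q • y) ≡ (p ℚ.* q) • (x *K y)
  •-*K p q (x₁ , x₂) (y₁ , y₂) = cong₂ _,_ (first p q Dℚ x₁ x₂ y₁ y₂) (second p q x₁ x₂ y₁ y₂)
    where
      open ℚ-Solver renaming (solve to ℚ-solve)
      first : ∀ p q d x₁ x₂ y₁ y₂ →
        p ℚ.* x₁ ℚ.* (q ℚ.* y₁) ℚ.+ d ℚ.* (p ℚ.* x₂ ℚ.* (q ℚ.* y₂))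
          ≡ p ℚ.* q ℚ.* (x₁ ℚ.* y₁ ℚ.+ d ℚ.* (x₂ ℚ.* y₂))
      first = ℚ-solve 7 (λ p q d x₁ x₂ y₁ y₂ →
        p :* x₁ :* (q :* y₁) :+ d :* (p :* x₂ :* (q :* y₂)) := p :* q :* (x₁ :* y₁ :+ d :* (x₂ :* y₂))) refl
      second : ∀ p q x₁ x₂ y₁ y₂ →
        p ℚ.* x₁ ℚ.* (q ℚ.* y₂) ℚ.+ p ℚ.* x₂ ℚ.* (q ℚ.* y₁) ≡ p ℚ.* q ℚ.* (x₁ ℚ.* y₂ ℚ.+ x₂ ℚ.* y₁)
      second = ℚ-solve 6 (λ p q x₁ x₂ y₁ y₂ →
        p :* x₁ :* (q :* y₂) :+ p :* x₂ :* (q :* y₁) := p :* q :* (x₁ :* y₂ :+ x₂ :* y₁)) refl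

  •-^K : ∀ k x n → (ι k • x) ^K n ≡ ι (k ^ℤ n) • (x ^K n)
  •-^K k x zero = refl
  •-^K k x (suc n) = begin
    (ι k • x) *K ((ι k • x) ^K n)              ≡⟨ cong ((ι k • x) *K_) (•-^K k x n) ⟩
    (ι k • x) *K (ι (k ^ℤ n) • (x ^K n))       ≡⟨ •-*K (ι k) (ι (k ^ℤ n)) x (x ^K n) ⟩
    (ι k ℚ.* ι (k ^ℤ n)) • (x *K (x ^K n))     ≡⟨ cong (_• (x *K (x ^K n))) (ι-* k (k ^ℤ n)) ⟨
    ι (k * k ^ℤ n) • (x *K (x ^K n))           ∎
    where open ≡-Reasoning

  •-cancel : ∀ {k} x → k ≢ 0ℤ → ι k • x ≡ 0K → x ≡ 0K
  •-cancel (x₁ , x₂) k≢0 eq =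
    cong₂ _,_ (ι*p≡0⇒p≡0 x₁ k≢0 (cong proj₁ eq)) (ι*p≡0⇒p≡0 x₂ k≢0 (cong proj₂ eq))

  ιK-assoc : ∀ k l x → ιK k *K (ιK l *K x) ≡ ιK (k * l) *K x
  ιK-assoc k l x = begin
    ιK k *K (ιK l *K x)  ≡⟨ trans (ιK*K≡• k (ιK l *K x)) (cong (ι k •_) (ιK*K≡• l x)) ⟩
    ι k • ι l • x        ≡⟨ •-assoc (ι k) (ι l) x ⟩
    (ι k ℚ.* ι l) • x    ≡⟨ cong (_• x) (ι-* k l) ⟨
    ι (k * l) • x        ≡⟨ ιK*K≡• (k * l) x ⟨
    ιK (k * l) *K x      ∎
    where open ≡-Reasoning

  ιK-*K-interchange : ∀ k l x y → (ιK k *K x) *K (ιK l *K y) ≡ ιK (k * l) *K (x *K y)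
  ιK-*K-interchange k l x y = begin
    (ιK k *K x) *K (ιK l *K y)  ≡⟨ cong₂ _*K_ (ιK*K≡• k x) (ιK*K≡• l y) ⟩
    (ι k • x) *K (ι l • y)      ≡⟨ •-*K (ι k) (ι l) x y ⟩
    (ι k ℚ.* ι l) • (x *K y)    ≡⟨ cong (_• (x *K y)) (ι-* k l) ⟨
    ι (k * l) • (x *K y)        ≡⟨ ιK*K≡• (k * l) (x *K y) ⟨
    ιK (k * l) *K (x *K y)      ∎
    where open ≡-Reasoning

  ιK-cancel : ∀ {k} x → k ≢ 0ℤ → ιK k *K x ≡ 0K → x ≡ 0K
  ιK-cancel {k} x k≢0 = •-cancel x k≢0 ∘ trans (sym (ιK*K≡• k x))

  K-scalable : IsScalable K-signature
  K-scalable = record { ⊙-distrib = ⊙-distrib ; ⊙-comm = ⊙-comm ; ⊙-^ = ⊙-^ }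
    where
      ⊙-distrib : ∀ k x y → ιK k *K (x +K y) ≡ (ιK k *K x) +K (ιK k *K y)
      ⊙-distrib k x y = trans (ιK*K≡• k (x +K y))
        (trans (•-distrib (ι k) x y) (sym (cong₂ _+K_ (ιK*K≡• k x) (ιK*K≡• k y))))
      ⊙-comm : ∀ k l x → ιK k *K (ιK l *K x) ≡ ιK l *K (ιK k *K x)
      ⊙-comm k l x = trans (ιK-assoc k l x)
        (trans (cong (λ j → ιK j *K x) (ℤₚ.*-comm k l)) (sym (ιK-assoc l k x)))
      ⊙-^ : ∀ k x n → (ιK k *K x) ^K n ≡ ιK (k ^ℤ n) *K (x ^K n)
      ⊙-^ k x n = trans (cong (_^K n) (ιK*K≡• k x))
        (trans (•-^K k x n) (sym (ιK*K≡• (k ^ℤ n) (x ^K n))))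

  toK : ℤ[√D] → K
  toK (m , k) = (ι m , ι k)

  toK-+ᴰ : ∀ x y → toK (x +ᴰ y) ≡ toK x +K toK y
  toK-+ᴰ (m , k) (n , l) = cong₂ _,_ (ι-+ m n) (ι-+ k l)

  toK-⊙ᴰ : ∀ t x → toK (t ⊙ᴰ x) ≡ ιK t *K toK x
  toK-⊙ᴰ t (m , k) = trans (cong₂ _,_ (ι-* t m) (ι-* t k)) (sym (ιK*K≡• t (toK (m , k))))

  toK-*ᴰ : ∀ x y → toK (x *ᴰ y) ≡ toK x *K toK y
  toK-*ᴰ (m , k) (n , l) = cong₂ _,_
    (trans (ι-+ (m * n) (D * (k * l)))
           (cong₂ ℚ._+_ (ι-* m n) (trans (ι-* D (k * l)) (cong (Dℚ ℚ.*_) (ι-* k l)))))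
    (trans (ι-+ (m * l) (k * n)) (cong₂ ℚ._+_ (ι-* m l) (ι-* k n)))

  toK-^ᴰ : ∀ x n → toK (x ^ᴰ n) ≡ toK x ^K n
  toK-^ᴰ x zero = refl
  toK-^ᴰ x (suc n) = trans (toK-*ᴰ x (x ^ᴰ n)) (cong (toK x *K_) (toK-^ᴰ x n))

  toK-isFermatHomomorphism : IsFermatHomomorphism {signature} {K-signature} toK
  toK-isFermatHomomorphism = record { ∔-homo = toK-+ᴰ ; ⊙-homo = toK-⊙ᴰ ; ^-homo = toK-^ᴰ }

  toK-injective : Injective _≡_ _≡_ toK
  toK-injective {m , k} {n , l} eq = cong₂ _,_ (ι-injective (cong proj₁ eq)) (ι-injective (cong proj₂ eq))

  toK-triple : ∀ x y z → toK (x *ᴰ (y *ᴰ z)) ≡ toK x *K (toK y *K toK z)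
  toK-triple x y z = trans (toK-*ᴰ x (y *ᴰ z)) (cong (toK x *K_) (toK-*ᴰ y z))

  toK-evalMonic : ∀ cs x → evalMonic cs (toK x) ≡ toK (evalMonicᴰ cs x)
  toK-evalMonic [] x = refl
  toK-evalMonic (c ∷ cs) x = sym (begin
    toK (fromℤ c +ᴰ x *ᴰ evalMonicᴰ cs x)        ≡⟨ toK-+ᴰ (fromℤ c) (x *ᴰ evalMonicᴰ cs x) ⟩
    ιK c +K toK (x *ᴰ evalMonicᴰ cs x)          ≡⟨ cong (ιK c +K_) (toK-*ᴰ x (evalMonicᴰ cs x)) ⟩
    ιK c +K (toK x *K toK (evalMonicᴰ cs x))    ≡⟨ cong (λ t → ιK c +K (toK x *K t)) (toK-evalMonic cs x) ⟨
    ιK c +K (toK x *K evalMonic cs (toK x))     ∎)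
    where open ≡-Reasoning

  toK-integral : ∀ x → InOK (toK x)
  toK-integral x = charPoly x , trans (toK-evalMonic (charPoly x) x) (cong toK (charPoly-root x))

  Clears : ℤ → K → Set
  Clears d x = ∃[ ρ ] toK ρ ≡ ιK d *K x

  clear : ∀ x → ∃[ d ] d ≢ 0ℤ × Clears d x
  clear (x₁ , x₂) = ↧ x₁ * ↧ x₂ , *-≢0 {↧ x₁} {↧ x₂} (λ ()) (λ ()) ,
    (↧ x₂ * ↥ x₁ , ↧ x₁ * ↥ x₂) , sym (trans (ιK*K≡• (↧ x₁ * ↧ x₂) (x₁ , x₂)) (cong₂ _,_ first second))
    where
      first : ι (↧ x₁ * ↧ x₂) ℚ.* x₁ ≡ ι (↧ x₂ * ↥ x₁)
      first = trans (cong (λ d → ι d ℚ.* x₁) (ℤₚ.*-comm (↧ x₁) (↧ x₂))) (ι[m*↧p]*p≡ι[m*↥p] (↧ x₂) x₁)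
      second : ι (↧ x₁ * ↧ x₂) ℚ.* x₂ ≡ ι (↧ x₁ * ↥ x₂)
      second = ι[m*↧p]*p≡ι[m*↥p] (↧ x₁) x₂

  clears-*ˡ : ∀ m {d x} → Clears d x → Clears (m * d) x
  clears-*ˡ m {d} {x} (ρ , toKρ≡dx) =
    m ⊙ᴰ ρ , trans (toK-⊙ᴰ m ρ) (trans (cong (ιK m *K_) toKρ≡dx) (ιK-assoc m d x))

  commonDenominator : ∀ x y z → ∃[ N ] N ≢ 0ℤ × Clears N x × Clears N y × Clears N z
  commonDenominator x y z = combine (clear x) (clear y) (clear z)
    where
      combine : ∃[ d ] d ≢ 0ℤ × Clears d x → ∃[ d ] d ≢ 0ℤ × Clears d y → ∃[ d ] d ≢ 0ℤ × Clears d z →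
                ∃[ N ] N ≢ 0ℤ × Clears N x × Clears N y × Clears N z
      combine (dx , dx≢0 , cx) (dy , dy≢0 , cy) (dz , dz≢0 , cz) =
        dx * (dy * dz) , *-≢0 {dx} dx≢0 (*-≢0 {dy} dy≢0 dz≢0) ,
        subst (λ N → Clears N x) (ℤₚ.*-comm (dy * dz) dx) (clears-*ˡ (dy * dz) cx) ,
        subst (λ N → Clears N y) reorder (clears-*ˡ (dx * dz) cy) ,
        subst (λ N → Clears N z) (ℤₚ.*-assoc dx dy dz) (clears-*ˡ (dx * dy) cz)
        where
          reorder : dx * dz * dy ≡ dx * (dy * dz)
          reorder = solve (dx ∷ dy ∷ dz ∷ [])

  solvable⇒KSolvable : ∀ {u v w n} → Solvable u v w n → KSolvable u v w n
  solvable⇒KSolvable {u} {v} {w} {n} (solution x y z norm≢0 eq) =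
    toK x , toK y , toK z , toK-integral x , toK-integral y , toK-integral z ,
    product≢0 , fermat-image u v w n eq
    where
      open IsFermatHomomorphism toK-isFermatHomomorphism using (fermat-image)
      product≢0 : ¬ (toK x *K (toK y *K toK z) ≡ 0K)
      product≢0 product≡0 = norm≢0 (begin
        norm (x *ᴰ (y *ᴰ z))  ≡⟨ cong norm (toK-injective {x *ᴰ (y *ᴰ z)} {0ᴰ} (trans (toK-triple x y z) product≡0)) ⟩
        norm 0ᴰ               ≡⟨ norm-0ᴰ ⟩
        0ℤ                    ∎)
        where open ≡-Reasoning

  KSolvable⇒solvable : ¬ IsSquareℤ D → ∀ {u v w n} → KSolvable u v w n → Solvable u v w n
  KSolvable⇒solvable ¬square {u} {v} {w} {n} (x , y , z , _ , _ , _ , xyz≢0 , eq) =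
    cleared (commonDenominator x y z)
    where
      cleared : ∃[ N ] N ≢ 0ℤ × Clears N x × Clears N y × Clears N z → Solvable u v w n
      cleared (N , N≢0 , (ρx , ρx≡) , (ρy , ρy≡) , (ρz , ρz≡)) =
        solution ρx ρy ρz norm≢0
          (fermat-preimage toK-injective u v w n ρx≡ ρy≡ ρz≡ (IsScalable.fermat-scale K-scalable N u v w n eq))
        where
          open IsFermatHomomorphism toK-isFermatHomomorphism using (fermat-preimage)
          open ≡-Reasoning
          product : toK (ρx *ᴰ (ρy *ᴰ ρz)) ≡ ιK (N * (N * N)) *K (x *K (y *K z))
          product = begin
            toK (ρx *ᴰ (ρy *ᴰ ρz))                       ≡⟨ toK-triple ρx ρy ρz ⟩
            toK ρx *K (toK ρy *K toK ρz)                 ≡⟨ cong₂ (λ p q → p *K (q *K toK ρz)) ρx≡ ρy≡ ⟩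
            (ιK N *K x) *K ((ιK N *K y) *K toK ρz)       ≡⟨ cong (λ r → (ιK N *K x) *K ((ιK N *K y) *K r)) ρz≡ ⟩
            (ιK N *K x) *K ((ιK N *K y) *K (ιK N *K z))  ≡⟨ cong ((ιK N *K x) *K_) (ιK-*K-interchange N N y z) ⟩
            (ιK N *K x) *K (ιK (N * N) *K (y *K z))      ≡⟨ ιK-*K-interchange N (N * N) x (y *K z) ⟩
            ιK (N * (N * N)) *K (x *K (y *K z))          ∎
          norm≢0 : norm (ρx *ᴰ (ρy *ᴰ ρz)) ≢ 0ℤ
          norm≢0 norm≡0 = xyz≢0 (ιK-cancel (x *K (y *K z)) (*-≢0 {N} N≢0 (*-≢0 {N} N≢0 N≢0)) (begin
            ιK (N * (N * N)) *K (x *K (y *K z))  ≡⟨ product ⟨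
            toK (ρx *ᴰ (ρy *ᴰ ρz))               ≡⟨ cong toK (norm≡0⇒≡0ᴰ ¬square (ρx *ᴰ (ρy *ᴰ ρz)) norm≡0) ⟩
            toK 0ᴰ                               ∎))

module _ (D : ℤ) where
  open QuadraticOrder D
  open QuadraticField D

  solvable⇒OKSolvable : ∀ {u v w n} → Solvable u v w n → OKSolvable D u v w n
  solvable⇒OKSolvable sol with isSquare? D
  ... | yes (s , s²≡D) = inj₁ ((s , s²≡D) , solvable⇒integerSolvable s s²≡D sol)
  ... | no ¬square = inj₂ (¬square , solvable⇒KSolvable sol)

  OKSolvable⇒solvable : ∀ {u v w n} → OKSolvable D u v w n → Solvable u v w n
  OKSolvable⇒solvable (inj₁ (_ , sol)) = integerSolvable⇒solvable sol
  OKSolvable⇒solvable (inj₂ (¬square , sol)) = KSolvable⇒solvable ¬square sol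

theorem3p4 : (a b c : ℤ) → ¬ (b * c ≡ + 0) → gcd3≡1 a b c →
    (u v w : ℤ) → ¬ (u ≡ + 0) → ¬ (v ≡ + 0) → ¬ (w ≡ + 0) → gcd3≡1 u v w →
    (n : ℕ) → .{{_ : NonZero n}} →
    MatrixSolvable (mat a b c (+ 0)) u v w n
      ⇔ OKSolvable (a * a + (+ 4) * (b * c)) u v w n
theorem3p4 a b c bc≢0 _ u v w _ _ _ _ n =
  mk⇔ (solvable⇒OKSolvable D ∘ matrixSolvable⇒solvable b≢0 {u} {v} {w} {n})
      (solvable⇒matrixSolvable ∘ OKSolvable⇒solvable D {u} {v} {w} {n})
  where
    open Centraliser a b c
    D = a * a + + 4 * (b * c)
    b≢0 : b ≢ 0ℤ
    b≢0 refl = bc≢0 refl
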